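{- There exist an interval partition $\{J_n:n\in\omega\}$ of $\omega$ and measures $\bar\mu=\langle\mu_n:n\in\omega\rangle$, with $\mu_n$ a measure on $J_n$ taking value at most $1$ on singletons and $\mu_n(J_n)\geq n$, such that $\Delta_{\text{1-1}}\geq\operatorname{cov}^*(\mathcal{ED}_{\bar\mu})$ and $\mathfrak{ros}_{\text{1-1}}\leq\operatorname{non}^*(\mathcal{ED}_{\bar\mu})$.
   Context: Given such $\{J_n\}$ and $\bar\mu$, $\mathcal{ED}_{\bar\mu}=\{A\subseteq\omega:\exists k\in\omega\ \forall n\in\omega\ (\mu_n(J_n\cap A)\leq k)\}$ (a tall ideal). For a tall ideal $\mathcal{I}$ on $\omega$: $\operatorname{cov}^*(\mathcal{I})=\min\{|\mathcal{A}|:\mathcal{A}\subseteq\mathcal{I},\ \forall X\in[\omega]^\omega\ \exists A\in\mathcal{A}\ (|A\cap X|=\aleph_0)\}$ and $\operatorname{non}^*(\mathcal{I})=\min\{|\mathcal{X}|:\mathcal{X}\subseteq[\omega]^\omega,\ \forall A\in\mathcal{I}\ \exists X\in\mathcal{X}\ (|A\cap X|<\aleph_0)\}$. Let $\square_{\text{1-1}}$ be the set of injective $f\in\omega^\omega$ without fixed points; $\Delta_{\text{1-1}}$ is the least size of $\mathcal{F}\subseteq\square_{\text{1-1}}$ such that for every $A\in[\omega]^\omega$ some $f\in\mathcal{F}$ has $f[A]\cap A$ infinite; $\mathfrak{ros}_{\text{1-1}}$ is the least size of $\mathcal{A}\subseteq[\omega]^\omega$ such that for every $f\in\square_{\text{1-1}}$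 some $A\in\mathcal{A}$ has $f[A]\cap A$ finite. -}

module Defs where

open import Data.Nat using (ℕ; zero; suc; _∸_) renaming (_≤_ to _≤ℕ_; _<_ to _<ℕ_)
open import Data.Bool using (Bool; true; false; if_then_else_)
open import Data.Integer using (+_)
open import Data.Rational using (ℚ; 0ℚ; 1ℚ; _/_; _+_; _≤_)
open import Data.Product using (Σ; ∃; _×_; _,_)
open import Relation.Nullary using (¬_)
open import Relation.Binary.PropositionalEquality using (_≡_; _≢_)

Subset : Set
Subset = ℕ → Bool

_∈_ : ℕ → Subset → Set
n ∈ A = A n ≡ true

InfiniteP : (ℕ → Set) → Set
InfiniteP P = ∀ m → ∃ λ n → m ≤ℕ n × P n

FiniteP : (ℕ → Set) → Set
FiniteP P = ∃ λ b → ∀ n → b ≤ℕ n → ¬ P n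

InfiniteSet : Subset → Set
InfiniteSet A = InfiniteP (λ n → n ∈ A)

_∈_∩_ : ℕ → Subset → Subset → Set
n ∈ A ∩ X = n ∈ A × n ∈ X

ImgMeet : (ℕ → ℕ) → Subset → ℕ → Set
ImgMeet f A n = n ∈ A × ∃ λ m → m ∈ A × f m ≡ n

Square11 : (ℕ → ℕ) → Set
Square11 f = (∀ m n → f m ≡ f n → m ≡ n) × (∀ n → f n ≢ n)

ℕtoℚ : ℕ → ℚ
ℕtoℚ k = (+ k) / 1

-- Interval partition given by a strictly increasing p with p 0 = 0:
-- J_n = [p n , p (suc n)).
IsIntervalPartition : (ℕ → ℕ) → Set
IsIntervalPartition p = (p 0 ≡ 0) × (∀ n → p n <ℕ p (suc n))

sumFrom : (ℕ → ℚ) → ℕ → ℕ → ℚ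
sumFrom g a zero = 0ℚ
sumFrom g a (suc len) = g a + sumFrom g (suc a) len

-- Measures μ_n on J_n are given by point weights w (each point of ω lies in
-- exactly one J_n); μ_n(J_n ∩ A) = Σ_{i ∈ J_n ∩ A} w i.
μ : (p : ℕ → ℕ) → (w : ℕ → ℚ) → ℕ → Subset → ℚ
μ p w n A = sumFrom (λ i → if A i then w i else 0ℚ) (p n) (p (suc n) ∸ p n)

IsGoodMeasures : (ℕ → ℕ) → (ℕ → ℚ) → Set
IsGoodMeasures p w =
  (∀ i → 0ℚ ≤ w i) × (∀ i → w i ≤ 1ℚ) × (∀ n → ℕtoℚ n ≤ μ p w n (λ _ → true))

InED : (ℕ → ℕ) → (ℕ → ℚ) → Subset → Set
InED p w A = ∃ λ (k : ℕ) → ∀ n → μ p w n A ≤ ℕtoℚ k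

-- Δ_{1-1} ≥ cov*(ED): every Δ_{1-1}-witnessing family F (indexed by I) yields a
-- cov*(ED)-witnessing family indexed by the same I (so of size ≤ |F|).
IsDeltaFamily : (I : Set) → (I → ℕ → ℕ) → Set
IsDeltaFamily I F =
  (∀ i → Square11 (F i)) ×
  (∀ A → InfiniteSet A → ∃ λ i → InfiniteP (ImgMeet (F i) A))

IsCovStarFamily : (ℕ → ℕ) → (ℕ → ℚ) → (I : Set) → (I → Subset) → Set
IsCovStarFamily p w I 𝒜 =
  (∀ i → InED p w (𝒜 i)) ×
  (∀ X → InfiniteSet X → ∃ λ i → InfiniteP (λ n → n ∈ 𝒜 i ∩ X))

DeltaGeCovStar : (ℕ → ℕ) → (ℕ → ℚ) → Set₁
DeltaGeCovStar p w =
  (I : Set) (F : I → ℕ → ℕ) → IsDeltaFamily I F →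
  Σ (I → Subset) (IsCovStarFamily p w I)

IsNonStarFamily : (ℕ → ℕ) → (ℕ → ℚ) → (I : Set) → (I → Subset) → Set
IsNonStarFamily p w I 𝒳 =
  (∀ i → InfiniteSet (𝒳 i)) ×
  (∀ A → InED p w A → ∃ λ i → FiniteP (λ n → n ∈ A ∩ 𝒳 i))

IsRosFamily : (I : Set) → (I → Subset) → Set
IsRosFamily I 𝒜 =
  (∀ i → InfiniteSet (𝒜 i)) ×
  (∀ f → Square11 f → ∃ λ i → FiniteP (ImgMeet f (𝒜 i)))

RosLeNonStar : (ℕ → ℕ) → (ℕ → ℚ) → Set₁
RosLeNonStar p w =
  (I : Set) (𝒳 : I → Subset) → IsNonStarFamily p w I 𝒳 →
  Σ (I → Subset) (IsRosFamily I)

{-# OPTIONS --safe #-}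
-- Give every point of J_n the weight 1/(p n + 1). For an injection f, call m linked back
-- if f m = k or f k = m for some k below the block of m. Each k is linked to at most two
-- points, so J_n holds at most 2·p n linked-back points and the linked-back set lies in
-- ED with bound 2. Keeping only the least point of X in each block gives an infinite
-- X′ ⊆ X meeting every block at most once. If f has no fixed points and a, f a ∈ X′, then
-- a and f a lie in different blocks and the later one is linked back; hence f[X′] ∩ X′
-- infinite forces (linked back) ∩ X infinite, and (linked back) ∩ X finite forces
-- f[X′] ∩ X′ finite. Blocks of length (n + 1)(p n + 1) make μ_n(J_n) = n + 1.

module Submission where

open import Defs
open import Data.Nat using (ℕ)
open import Data.Rational using (ℚ)
open import Data.Product using (Σ; _×_)

open import Algebra.Bundles using (Ring)
open import Data.Bool as Bool using (true; false; if_then_else_)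
open import Data.Empty using (⊥-elim)
open import Data.Integer as ℤ using (+_)
import Data.Integer.Properties as ℤ
open import Data.Nat as ℕ using (zero; suc; _≤_; _<_; z≤n; s≤s; _≟_)
open import Data.Nat.Induction using (<-rec)
import Data.Nat.Properties as ℕ
open import Data.Product using (∃; _,_; proj₁; proj₂)
open import Data.Rational as ℚ using (0ℚ; 1ℚ; toℚᵘ)
import Data.Rational.Properties as ℚ
import Data.Rational.Unnormalised as ℚᵘ
import Data.Rational.Unnormalised.Properties as ℚᵘ
open import Data.Sum using (_⊎_; inj₁; inj₂)
open import Function using (case_of_)
open import Relation.Binary.Definitions using (tri<; tri≈; tri>)
open import Relation.Binary.PropositionalEquality
open import Relation.Nullary using (Dec; yes; no; does; ¬_; ¬?; _×-dec_; _⊎-dec_)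
open import Relation.Nullary.Decidable using (dec-true)
open import Relation.Unary using (Pred; Decidable)
open import Level using (0ℓ)

open import Algebra.Properties.Semiring.Mult (Ring.semiring ℚ.+-*-ring)
  using (×-assoc-*; ×-assocˡ) renaming (_×_ to _·_)

1/[1+_] : ℕ → ℚ
1/[1+ k ] = + 1 ℚ./ suc k

ℕtoℚ-suc : ∀ k → ℕtoℚ (suc k) ≡ 1ℚ ℚ.+ ℕtoℚ k
ℕtoℚ-suc k = ℚ.toℚᵘ-injective (begin
  toℚᵘ (ℕtoℚ (suc k))              ≈⟨ ℚ.toℚᵘ-fromℚᵘ (ℚᵘ.mkℚᵘ (+ suc k) 0) ⟩
  ℚᵘ.mkℚᵘ (+ suc k) 0              ≈⟨ ℚᵘ.*≡* (cong (λ z → (+ 1 ℤ.+ z) ℤ.* + 1) (sym (ℤ.*-identityʳ (+ k)))) ⟩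
  ℚᵘ.1ℚᵘ ℚᵘ.+ ℚᵘ.mkℚᵘ (+ k) 0      ≈⟨ ℚᵘ.+-cong (ℚ.toℚᵘ-fromℚᵘ (ℚᵘ.mkℚᵘ (+ 1) 0)) (ℚ.toℚᵘ-fromℚᵘ (ℚᵘ.mkℚᵘ (+ k) 0)) ⟨
  toℚᵘ 1ℚ ℚᵘ.+ toℚᵘ (ℕtoℚ k)       ≈⟨ ℚ.toℚᵘ-homo-+ 1ℚ (ℕtoℚ k) ⟨
  toℚᵘ (1ℚ ℚ.+ ℕtoℚ k)             ∎)
  where open ℚᵘ.≃-Reasoning

ℕtoℚ[1+n]*1/[1+n]≡1 : ∀ n → ℕtoℚ (suc n) ℚ.* 1/[1+ n ] ≡ 1ℚ
ℕtoℚ[1+n]*1/[1+n]≡1 n = ℚ.toℚᵘ-injective (begin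
  toℚᵘ (ℕtoℚ (suc n) ℚ.* 1/[1+ n ])            ≈⟨ ℚ.toℚᵘ-homo-* (ℕtoℚ (suc n)) 1/[1+ n ] ⟩
  toℚᵘ (ℕtoℚ (suc n)) ℚᵘ.* toℚᵘ 1/[1+ n ]      ≈⟨ ℚᵘ.*-cong (ℚ.toℚᵘ-fromℚᵘ (ℚᵘ.mkℚᵘ (+ suc n) 0))
                                                               (ℚ.toℚᵘ-fromℚᵘ (ℚᵘ.mkℚᵘ (+ 1) n)) ⟩
  ℚᵘ.mkℚᵘ (+ suc n) 0 ℚᵘ.* ℚᵘ.mkℚᵘ (+ 1) n    ≈⟨ ℚᵘ.*≡* (cong (λ m → + suc m) n*1*1≡n+0+0) ⟩
  ℚᵘ.1ℚᵘ                                        ∎)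
  where
  open ℚᵘ.≃-Reasoning
  n*1*1≡n+0+0 : n ℕ.* 1 ℕ.* 1 ≡ n ℕ.+ 0 ℕ.+ 0
  n*1*1≡n+0+0 = trans (ℕ.*-identityʳ (n ℕ.* 1))
                  (trans (ℕ.*-identityʳ n) (sym (trans (ℕ.+-identityʳ _) (ℕ.+-identityʳ n))))

·1ℚ≡ℕtoℚ : ∀ n → n · 1ℚ ≡ ℕtoℚ n
·1ℚ≡ℕtoℚ zero    = refl
·1ℚ≡ℕtoℚ (suc n) = trans (cong (1ℚ ℚ.+_) (·1ℚ≡ℕtoℚ n)) (sym (ℕtoℚ-suc n))

[1+n]·1/[1+n]≡1 : ∀ n → suc n · 1/[1+ n ] ≡ 1ℚ
[1+n]·1/[1+n]≡1 n = begin
  suc n · 1/[1+ n ]              ≡⟨ cong (suc n ·_) (ℚ.*-identityˡ 1/[1+ n ]) ⟨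
  suc n · (1ℚ ℚ.* 1/[1+ n ])     ≡⟨ ×-assoc-* (suc n) 1ℚ 1/[1+ n ] ⟨
  (suc n · 1ℚ) ℚ.* 1/[1+ n ]     ≡⟨ cong (ℚ._* 1/[1+ n ]) (·1ℚ≡ℕtoℚ (suc n)) ⟩
  ℕtoℚ (suc n) ℚ.* 1/[1+ n ]     ≡⟨ ℕtoℚ[1+n]*1/[1+n]≡1 n ⟩
  1ℚ                             ∎
  where open ≡-Reasoning

0≤1/[1+n] : ∀ n → 0ℚ ℚ.≤ 1/[1+ n ]
0≤1/[1+n] n = ℚ.nonNegative⁻¹ 1/[1+ n ] {{ℚ.normalize-nonNeg 1 (suc n)}}

1/[1+n]≤1 : ∀ n → 1/[1+ n ] ℚ.≤ 1ℚ
1/[1+n]≤1 n = ℚ.toℚᵘ-cancel-≤ (ℚᵘ.≤-respˡ-≃ (ℚᵘ.≃-sym (ℚ.toℚᵘ-fromℚᵘ (ℚᵘ.mkℚᵘ (+ 1) n)))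
                                            (ℚᵘ.*≤* (ℤ.+≤+ (s≤s z≤n))))

·-nonNeg : ∀ {x} n → 0ℚ ℚ.≤ x → 0ℚ ℚ.≤ n · x
·-nonNeg zero    0≤x = ℚ.≤-refl
·-nonNeg (suc n) 0≤x = ℚ.+-mono-≤ 0≤x (·-nonNeg n 0≤x)

·-monoˡ-≤ : ∀ {x m n} → 0ℚ ℚ.≤ x → m ≤ n → m · x ℚ.≤ n · x
·-monoˡ-≤ {n = n} 0≤x z≤n     = ·-nonNeg n 0≤x
·-monoˡ-≤ {x}     0≤x (s≤s m≤n) = ℚ.+-monoʳ-≤ x (·-monoˡ-≤ 0≤x m≤n)

toSubset : {P : Pred ℕ 0ℓ} → Decidable P → Subset
toSubset P? n = does (P? n)

∈-toSubset⁺ : ∀ {P : Pred ℕ 0ℓ} (P? : Decidable P) {n} → P n → n ∈ toSubset P?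
∈-toSubset⁺ P? {n} = dec-true (P? n)

∈-toSubset⁻ : ∀ {P : Pred ℕ 0ℓ} (P? : Decidable P) {n} → n ∈ toSubset P? → P n
∈-toSubset⁻ P? {n} n∈ with P? n | n∈
... | yes Pn | _ = Pn

_≼_ : (ℕ → Set) → (ℕ → Set) → Set
P ≼ Q = ∀ {n} → P n → ∃ λ m → n ≤ m × Q m

≼-infinite : ∀ {P Q} → P ≼ Q → InfiniteP P → InfiniteP Q
≼-infinite P≼Q P-inf b =
  let (n , b≤n , Pn) = P-inf b
      (m , n≤m , Qm) = P≼Q Pn
  in m , ℕ.≤-trans b≤n n≤m , Qm

≼-finite : ∀ {P Q} → P ≼ Q → FiniteP Q → FiniteP P
≼-finite P≼Q (b , Q-fin) =
  b , λ n b≤n Pn → let (m , n≤m , Qm) = P≼Q Pn in Q-fin m (ℕ.≤-trans b≤n n≤m) Qm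

count : Subset → ℕ → ℕ → ℕ
count A a zero    = 0
count A a (suc L) = if A a then suc (count A (suc a) L) else count A (suc a) L

count-step : ∀ A a L → count A (suc a) L ≤ count A a (suc L)
count-step A a L with A a
... | true  = ℕ.n≤1+n _
... | false = ℕ.≤-refl

count-none : ∀ {A a} L → (∀ {i} → a ≤ i → ¬ i ∈ A) → count A a L ≡ 0
count-none zero _ = refl
count-none {A} {a} (suc L) none with A a in Aa
... | true  = ⊥-elim (none ℕ.≤-refl Aa)
... | false = count-none L (λ a<i → none (ℕ.<⇒≤ a<i))

count-≤1 : ∀ {A} a L → (∀ {i j} → i ∈ A → j ∈ A → i ≡ j) → count A a L ≤ 1
count-≤1 a zero _ = z≤n
count-≤1 {A} a (suc L) atMostOne with A a in Aa
... | true  = ℕ.≤-reflexive (cong suc (count-none L λ a<i i∈A → ℕ.<-irrefl (atMostOne Aa i∈A) a<i))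
... | false = count-≤1 (suc a) L atMostOne

count-⊆∪ : ∀ {A B C} a L → (∀ {i} → i ∈ C → i ∈ A ⊎ i ∈ B) →
           count C a L ≤ count A a L ℕ.+ count B a L
count-⊆∪ a zero _ = z≤n
count-⊆∪ {A} {B} {C} a (suc L) C⊆A∪B with C a in Ca | count-⊆∪ (suc a) L C⊆A∪B
... | false | ih = ℕ.≤-trans ih (ℕ.+-mono-≤ (count-step A a L) (count-step B a L))
... | true  | ih with C⊆A∪B Ca
...   | inj₁ Aa rewrite Aa = s≤s (ℕ.≤-trans ih (ℕ.+-monoʳ-≤ _ (count-step B a L)))
...   | inj₂ Ba rewrite Ba = begin
  suc (count C (suc a) L)                              ≤⟨ s≤s ih ⟩
  suc (count A (suc a) L ℕ.+ count B (suc a) L)        ≡⟨ ℕ.+-suc _ _ ⟨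
  count A (suc a) L ℕ.+ suc (count B (suc a) L)        ≤⟨ ℕ.+-monoˡ-≤ _ (count-step A a L) ⟩
  count A a (suc L) ℕ.+ suc (count B (suc a) L)        ∎
  where open ℕ.≤-Reasoning

count-all : ∀ a L → count (λ _ → true) a L ≡ L
count-all a zero    = refl
count-all a (suc L) = cong suc (count-all (suc a) L)

sumFrom-cong : ∀ {g h} a L → (∀ {i} → a ≤ i → i < a ℕ.+ L → g i ≡ h i) → sumFrom g a L ≡ sumFrom h a L
sumFrom-cong a zero    _   = refl
sumFrom-cong a (suc L) g≗h =
  cong₂ ℚ._+_ (g≗h ℕ.≤-refl (ℕ.m<m+n a ℕ.z<s))
              (sumFrom-cong (suc a) L λ {i} a<i i<1+a+L → g≗h (ℕ.<⇒≤ a<i) (subst (i <_) (sym (ℕ.+-suc a L)) i<1+a+L))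

sumFrom-indicator : ∀ A c a L → sumFrom (λ i → if A i then c else 0ℚ) a L ≡ count A a L · c
sumFrom-indicator A c a zero = refl
sumFrom-indicator A c a (suc L) with A a
... | true  = cong (c ℚ.+_) (sumFrom-indicator A c (suc a) L)
... | false = trans (ℚ.+-identityˡ _) (sumFrom-indicator A c (suc a) L)

count-anyUpTo : ∀ {R : ℕ → ℕ → Set} (R? : ∀ i k → Dec (R i k)) {c} a L →
                (∀ k → count (toSubset (λ i → R? i k)) a L ≤ c) →
                ∀ P → count (toSubset (λ i → ℕ.anyUpTo? (R? i) P)) a L ≤ P ℕ.* c
count-anyUpTo R? a L bound zero = ℕ.≤-reflexive (count-none L λ _ ())
count-anyUpTo R? a L bound (suc P) =
  ℕ.≤-trans (count-⊆∪ a L split) (ℕ.+-mono-≤ (bound P) (count-anyUpTo R? a L bound P))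
  where
  split : ∀ {i} → i ∈ toSubset (λ i → ℕ.anyUpTo? (R? i) (suc P)) →
          i ∈ toSubset (λ i → R? i P) ⊎ i ∈ toSubset (λ i → ℕ.anyUpTo? (R? i) P)
  split i∈ with ∈-toSubset⁻ (λ i → ℕ.anyUpTo? (R? i) (suc P)) i∈
  ... | k , k<1+P , Rik with ℕ.m<1+n⇒m<n∨m≡n k<1+P
  ...   | inj₁ k<P  = inj₂ (∈-toSubset⁺ (λ i → ℕ.anyUpTo? (R? i) P) (k , k<P , Rik))
  ...   | inj₂ refl = inj₁ (∈-toSubset⁺ (λ i → R? i P) Rik)

Linked : (ℕ → ℕ) → ℕ → ℕ → Set
Linked f i k = f i ≡ k ⊎ f k ≡ i

linked? : ∀ f i k → Dec (Linked f i k)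
linked? f i k = (f i ≟ k) ⊎-dec (f k ≟ i)

linkedBelow? : ∀ f P → Decidable (λ i → ∃ λ k → k < P × Linked f i k)
linkedBelow? f P i = ℕ.anyUpTo? (linked? f i) P

module _ {f : ℕ → ℕ} (f-injective : ∀ m n → f m ≡ f n → m ≡ n) where

  count-linked≤2 : ∀ k a L → count (toSubset (λ i → linked? f i k)) a L ≤ 2
  count-linked≤2 k a L =
    ℕ.≤-trans (count-⊆∪ a L split) (ℕ.+-mono-≤ (count-≤1 a L preimage-unique) (count-≤1 a L image-unique))
    where
    split : ∀ {i} → i ∈ toSubset (λ i → linked? f i k) →
            i ∈ toSubset (λ i → f i ≟ k) ⊎ i ∈ toSubset (λ i → f k ≟ i)
    split i∈ with ∈-toSubset⁻ (λ i → linked? f i k) i∈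
    ... | inj₁ fi≡k = inj₁ (∈-toSubset⁺ (λ i → f i ≟ k) fi≡k)
    ... | inj₂ fk≡i = inj₂ (∈-toSubset⁺ (λ i → f k ≟ i) fk≡i)
    preimage-unique : ∀ {i j} → i ∈ toSubset (λ i → f i ≟ k) → j ∈ toSubset (λ i → f i ≟ k) → i ≡ j
    preimage-unique {i} {j} i∈ j∈ =
      f-injective i j (trans (∈-toSubset⁻ (λ i → f i ≟ k) i∈) (sym (∈-toSubset⁻ (λ i → f i ≟ k) j∈)))
    image-unique : ∀ {i j} → i ∈ toSubset (λ i → f k ≟ i) → j ∈ toSubset (λ i → f k ≟ i) → i ≡ j
    image-unique i∈ j∈ = trans (sym (∈-toSubset⁻ (λ i → f k ≟ i) i∈)) (∈-toSubset⁻ (λ i → f k ≟ i) j∈)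

  count-linkedBelow : ∀ P a L → count (toSubset (linkedBelow? f P)) a L ≤ P ℕ.* 2
  count-linkedBelow P a L = count-anyUpTo (linked? f) a L (λ k → count-linked≤2 k a L) P

module IntervalPartition {p : ℕ → ℕ} (partition : IsIntervalPartition p) where

  p-<-suc : ∀ n → p n < p (suc n)
  p-<-suc = proj₂ partition

  p-mono-≤ : ∀ {m n} → m ≤ n → p m ≤ p n
  p-mono-≤ m≤n = mono′ (ℕ.≤⇒≤′ m≤n)
    where
    mono′ : ∀ {m n} → m ℕ.≤′ n → p m ≤ p n
    mono′ ℕ.≤′-refl         = ℕ.≤-refl
    mono′ (ℕ.≤′-step m≤′n) = ℕ.≤-trans (mono′ m≤′n) (ℕ.<⇒≤ (p-<-suc _))

  n≤p[n] : ∀ n → n ≤ p n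
  n≤p[n] zero    = z≤n
  n≤p[n] (suc n) = ℕ.≤-<-trans (n≤p[n] n) (p-<-suc n)

  InBlock : ℕ → ℕ → Set
  InBlock n i = p n ≤ i × i < p (suc n)

  blockLength : ℕ → ℕ
  blockLength n = p (suc n) ℕ.∸ p n

  p-inBlock : ∀ n → InBlock n (p n)
  p-inBlock n = ℕ.≤-refl , p-<-suc n

  block : ℕ → ℕ
  block zero = 0
  block (suc i) with suc i ℕ.<? p (suc (block i))
  ... | yes _ = block i
  ... | no  _ = suc (block i)

  ∈-block : ∀ i → InBlock (block i) i
  ∈-block zero = ℕ.≤-reflexive (proj₁ partition) , subst (_< p 1) (proj₁ partition) (p-<-suc 0)
  ∈-block (suc i) with suc i ℕ.<? p (suc (block i)) | ∈-block i
  ... | yes 1+i<  | p≤i , _ = ℕ.m≤n⇒m≤1+n p≤i , 1+i<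
  ... | no  1+i≮  | _ , i<  = ℕ.≮⇒≥ 1+i≮ , ℕ.≤-<-trans i< (p-<-suc _)

  inBlock-mono : ∀ {m n i j} → InBlock m i → InBlock n j → i ≤ j → m ≤ n
  inBlock-mono (p[m]≤i , _) (_ , j<p[1+n]) i≤j = ℕ.≮⇒≥ λ n<m →
    ℕ.<-irrefl refl (ℕ.<-≤-trans j<p[1+n] (ℕ.≤-trans (p-mono-≤ n<m) (ℕ.≤-trans p[m]≤i i≤j)))

  block-unique : ∀ {n i} → InBlock n i → block i ≡ n
  block-unique i∈J =
    ℕ.≤-antisym (inBlock-mono (∈-block _) i∈J ℕ.≤-refl) (inBlock-mono i∈J (∈-block _) ℕ.≤-refl)

  block-mono : ∀ {i j} → i ≤ j → block i ≤ block j
  block-mono = inBlock-mono (∈-block _) (∈-block _)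

  block-<⇒< : ∀ {i j} → block i < block j → i < j
  block-<⇒< b<b = ℕ.≰⇒> λ j≤i → ℕ.<⇒≱ b<b (block-mono j≤i)

  block-<⇒<p : ∀ {i j} → block i < block j → i < p (block j)
  block-<⇒<p {i} b<b = ℕ.<-≤-trans (proj₂ (∈-block i)) (p-mono-≤ b<b)

  EarlierInBlock : Subset → ℕ → Set
  EarlierInBlock X n = ∃ λ k → k < n × block k ≡ block n × k ∈ X

  earlierInBlock? : ∀ X → Decidable (EarlierInBlock X)
  earlierInBlock? X n = ℕ.anyUpTo? (λ k → (block k ≟ block n) ×-dec (X k Bool.≟ true)) n

  blockMinimum? : ∀ X → Decidable (λ n → n ∈ X × ¬ EarlierInBlock X n)
  blockMinimum? X n = (X n Bool.≟ true) ×-dec ¬? (earlierInBlock? X n)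

  blockMinima : Subset → Subset
  blockMinima X = toSubset (blockMinimum? X)

  blockMinima-⊆ : ∀ {X n} → n ∈ blockMinima X → n ∈ X
  blockMinima-⊆ {X} n∈ = proj₁ (∈-toSubset⁻ (blockMinimum? X) n∈)

  blockMinima-noEarlier : ∀ {X n} → n ∈ blockMinima X → ¬ EarlierInBlock X n
  blockMinima-noEarlier {X} n∈ = proj₂ (∈-toSubset⁻ (blockMinimum? X) n∈)

  blockMinima-unique : ∀ {X a b} → a ∈ blockMinima X → b ∈ blockMinima X → block a ≡ block b → a ≡ b
  blockMinima-unique {X} {a} {b} a∈ b∈ same with ℕ.<-cmp a b
  ... | tri< a<b _ _ = ⊥-elim (blockMinima-noEarlier {X} b∈ (a , a<b , same , blockMinima-⊆ {X} a∈))
  ... | tri≈ _ a≡b _ = a≡b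
  ... | tri> _ _ b<a = ⊥-elim (blockMinima-noEarlier {X} a∈ (b , b<a , sym same , blockMinima-⊆ {X} b∈))

  blockMinimum-exists : ∀ {X} n → n ∈ X → ∃ λ m → block m ≡ block n × m ∈ blockMinima X
  blockMinimum-exists {X} = <-rec (λ n → n ∈ X → ∃ λ m → block m ≡ block n × m ∈ blockMinima X)
    λ n descend n∈X → case earlierInBlock? X n of λ where
      (yes (k , k<n , same , k∈X)) → let (m , same′ , m∈) = descend k<n k∈X in m , trans same′ same , m∈
      (no none)                    → n , refl , ∈-toSubset⁺ (blockMinimum? X) (n∈X , none)

  blockMinima-infinite : ∀ {X} → InfiniteSet X → InfiniteSet (blockMinima X)
  blockMinima-infinite {X} X-inf b =
    let (n , p[b]≤n , n∈X) = X-inf (p b)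
        (m , same , m∈)    = blockMinimum-exists n n∈X
        b≤block[m]         = subst (b ≤_) (sym same) (inBlock-mono (p-inBlock b) (∈-block n) p[b]≤n)
    in m , ℕ.≤-trans b≤block[m] (ℕ.≤-trans (n≤p[n] (block m)) (proj₁ (∈-block m))) , m∈

  linkedBack : (ℕ → ℕ) → Subset
  linkedBack f i = toSubset (linkedBelow? f (p (block i))) i

  imgMeet≼linkedBack : ∀ {f X} → (∀ n → f n ≢ n) →
                       ImgMeet f (blockMinima X) ≼ (λ c → c ∈ linkedBack f ∩ X)
  imgMeet≼linkedBack {f} {X} noFix {n} (n∈ , a , a∈ , fa≡n) with ℕ.<-cmp (block a) (block n)
  ... | tri< a≺n _ _ =
    n , ℕ.≤-refl ,
    ∈-toSubset⁺ (linkedBelow? f _) (a , block-<⇒<p {j = n} a≺n , inj₂ fa≡n) , blockMinima-⊆ {X} n∈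
  ... | tri≈ _ same _ = ⊥-elim (noFix a (trans fa≡n (sym (blockMinima-unique {X} a∈ n∈ same))))
  ... | tri> _ _ n≺a =
    a , ℕ.<⇒≤ (block-<⇒< n≺a) ,
    ∈-toSubset⁺ (linkedBelow? f _) (n , block-<⇒<p {j = a} n≺a , inj₁ fa≡n) , blockMinima-⊆ {X} a∈

  weight : ℕ → ℚ
  weight i = 1/[1+ p (block i) ]

  μ-weight : ∀ {n A B} → (∀ {i} → InBlock n i → A i ≡ B i) →
             μ p weight n A ≡ count B (p n) (blockLength n) · 1/[1+ p n ]
  μ-weight {n} {A} {B} A≗B = trans (sumFrom-cong (p n) (blockLength n) onBlock)
                                   (sumFrom-indicator B 1/[1+ p n ] (p n) (blockLength n))
    where
    onBlock : ∀ {i} → p n ≤ i → i < p n ℕ.+ blockLength n →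
              (if A i then weight i else 0ℚ) ≡ (if B i then 1/[1+ p n ] else 0ℚ)
    onBlock {i} p[n]≤i i<end =
      let i∈J = p[n]≤i , subst (i <_) (ℕ.m+[n∸m]≡n (ℕ.<⇒≤ (p-<-suc n))) i<end
      in cong₂ (λ b x → if b then x else 0ℚ) (A≗B i∈J) (cong (λ m → 1/[1+ p m ]) (block-unique i∈J))

  linkedBack-∈ED : ∀ {f} → (∀ m n → f m ≡ f n → m ≡ n) → InED p weight (linkedBack f)
  linkedBack-∈ED {f} f-injective = 2 , λ n → begin
    μ p weight n (linkedBack f)                                     ≡⟨ μ-weight (onBlock n) ⟩
    count (toSubset (linkedBelow? f (p n))) (p n) (blockLength n) · 1/[1+ p n ]
                                                                    ≤⟨ ·-monoˡ-≤ (0≤1/[1+n] (p n)) (countBound n) ⟩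
    (2 ℕ.* suc (p n)) · 1/[1+ p n ]                                 ≡⟨ ×-assocˡ 1/[1+ p n ] 2 (suc (p n)) ⟨
    2 · (suc (p n) · 1/[1+ p n ])                                   ≡⟨ cong (2 ·_) ([1+n]·1/[1+n]≡1 (p n)) ⟩
    2 · 1ℚ                                                          ≡⟨ ·1ℚ≡ℕtoℚ 2 ⟩
    ℕtoℚ 2                                                          ∎
    where
    open ℚ.≤-Reasoning
    onBlock : ∀ n {i} → InBlock n i → linkedBack f i ≡ toSubset (linkedBelow? f (p n)) i
    onBlock n {i} i∈J = cong (λ m → toSubset (linkedBelow? f (p m)) i) (block-unique i∈J)
    countBound : ∀ n → count (toSubset (linkedBelow? f (p n))) (p n) (blockLength n) ≤ 2 ℕ.* suc (p n)
    countBound n = ℕ.≤-trans (count-linkedBelow f-injective (p n) (p n) (blockLength n))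
                             (ℕ.≤-trans (ℕ.*-monoˡ-≤ 2 (ℕ.n≤1+n (p n))) (ℕ.≤-reflexive (ℕ.*-comm (suc (p n)) 2)))

  deltaGeCovStar : DeltaGeCovStar p weight
  deltaGeCovStar I F (F-square , F-delta) =
    (λ i → linkedBack (F i)) , (λ i → linkedBack-∈ED (proj₁ (F-square i))) , cover
    where
    cover : ∀ X → InfiniteSet X → ∃ λ i → InfiniteP (λ n → n ∈ linkedBack (F i) ∩ X)
    cover X X-inf =
      let (i , meets) = F-delta (blockMinima X) (blockMinima-infinite X-inf)
      in i , ≼-infinite (imgMeet≼linkedBack (proj₂ (F-square i))) meets

  rosLeNonStar : RosLeNonStar p weight
  rosLeNonStar I 𝒳 (𝒳-infinite , 𝒳-nonStar) =
    (λ i → blockMinima (𝒳 i)) , (λ i → blockMinima-infinite (𝒳-infinite i)) , avoid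
    where
    avoid : ∀ f → Square11 f → ∃ λ i → FiniteP (ImgMeet f (blockMinima (𝒳 i)))
    avoid f (f-injective , noFix) =
      let (i , finite) = 𝒳-nonStar (linkedBack f) (linkedBack-∈ED f-injective)
      in i , ≼-finite (imgMeet≼linkedBack noFix) finite

starts : ℕ → ℕ
starts zero    = 0
starts (suc n) = starts n ℕ.+ suc n ℕ.* suc (starts n)

starts-partition : IsIntervalPartition starts
starts-partition = refl , λ n → ℕ.m<m+n (starts n) ℕ.z<s

open IntervalPartition starts-partition

starts-goodMeasures : IsGoodMeasures starts weight
starts-goodMeasures =
  (λ i → 0≤1/[1+n] (starts (block i))) , (λ i → 1/[1+n]≤1 (starts (block i))) , mass
  where
  mass : ∀ n → ℕtoℚ n ℚ.≤ μ starts weight n (λ _ → true)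
  mass n = begin
    ℕtoℚ n                                               ≡⟨ ·1ℚ≡ℕtoℚ n ⟨
    n · 1ℚ                                               ≤⟨ ·-monoˡ-≤ (ℚ.nonNegative⁻¹ 1ℚ) (ℕ.n≤1+n n) ⟩
    suc n · 1ℚ                                           ≡⟨ cong (suc n ·_) ([1+n]·1/[1+n]≡1 (starts n)) ⟨
    suc n · (suc (starts n) · q)                         ≡⟨ ×-assocˡ q (suc n) (suc (starts n)) ⟩
    (suc n ℕ.* suc (starts n)) · q                       ≡⟨ cong (_· q) length ⟨
    count (λ _ → true) (starts n) (blockLength n) · q    ≡⟨ μ-weight {n} {λ _ → true} (λ _ → refl) ⟨
    μ starts weight n (λ _ → true)                       ∎
    where
    open ℚ.≤-Reasoning
    q : ℚ
    q = 1/[1+ starts n ]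
    length : count (λ _ → true) (starts n) (blockLength n) ≡ suc n ℕ.* suc (starts n)
    length = trans (count-all (starts n) _) (ℕ.m+n∸m≡n (starts n) _)

mainTheorem14 : Σ (ℕ → ℕ) λ p → Σ (ℕ → ℚ) λ w →
                  IsIntervalPartition p × IsGoodMeasures p w ×
                  DeltaGeCovStar p w × RosLeNonStar p w
mainTheorem14 = starts , weight , starts-partition , starts-goodMeasures , deltaGeCovStar , rosLeNonStar
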